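{- Let $G$ be a finite connected graph with $n\ge 2$ vertices and maximum degree $\Delta$. Then $$\textit{VR}(G,1)\leq 1-\frac{1}{\Delta}+\frac{1}{n\Delta}.$$
   Context: The discrete Voronoi game on a finite graph $G$ with $t$ rounds: two players $\mathbf{A}$ and $\mathbf{B}$ alternately claim vertices of $G$, $\mathbf{A}$ first, each player claiming one vertex per round, for $t$ rounds (no vertex may be claimed twice). Distances are shortest-path distances in $G$. At the end, each vertex strictly closer to the set of $\mathbf{A}$'s claimed vertices than to the set of $\mathbf{B}$'s claimed vertices belongs to $\mathbf{A}$, each vertex strictly closer to $\mathbf{B}$'s set belongs to $\mathbf{B}$, and each vertex at equal distance is tied (each player receives half of it). The Voronoi ratio $\textit{VR}(G,t)$ is the number of vertices belonging to $\mathbf{A}$ plus half the number of tied vertices, divided by $|V(G)|$, when both players play optimally ($\mathbf{A}$ maximizing, $\mathbf{B}$ minimizing). -}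

module Defs where

open import Data.Bool using (Bool; true; false; _∧_; _∨_; if_then_else_)
open import Data.Nat using (ℕ; zero; suc; _+_; _*_; _⊓_; _⊔_; _<ᵇ_; _≡ᵇ_)
open import Data.Fin using (Fin)
open import Data.Fin.Properties using (_≟_)
open import Data.List using (List; map; foldr; allFin; filter)
open import Data.Nat.ListAction using (sum)
open import Data.Bool.ListAction using (any)
open import Data.Integer using (+_)
open import Data.Rational using (ℚ; _/_)
open import Relation.Nullary using (¬_)
open import Relation.Nullary.Decidable using (⌊_⌋)
open import Relation.Binary.PropositionalEquality using (_≡_)

record Graph (n : ℕ) : Set where
  field
    adj    : Fin n → Fin n → Bool
    sym    : ∀ u v → adj u v ≡ adj v u
    irrefl : ∀ v → adj v v ≡ false
open Graph public

module _ {n : ℕ} (G : Graph n) where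

  data Walk : Fin n → Fin n → Set where
    here : ∀ {u} → Walk u u
    step : ∀ {u v w} → adj G u v ≡ true → Walk v w → Walk u w

  Connected : Set
  Connected = ∀ u v → Walk u v

  reach : ℕ → Fin n → Fin n → Bool
  reach zero    u v = ⌊ u ≟ v ⌋
  reach (suc k) u v = reach k u v ∨ any (λ w → reach k u w ∧ adj G w v) (allFin n)

  -- shortest-path distance: least k ≤ n with reach k u v
  -- (the value n is returned if v is unreachable, which never happens
  --  in a connected graph, where all distances are < n)
  distFrom : ℕ → ℕ → Fin n → Fin n → ℕ
  distFrom k zero    u v = k
  distFrom k (suc f) u v = if reach k u v then k else distFrom (suc k) f u v

  dist : Fin n → Fin n → ℕ
  dist u v = distFrom 0 n u v

  degree : Fin n → ℕ
  degree v = sum (map (λ w → if adj G v w then 1 else 0) (allFin n))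

  maxDegree : ℕ
  maxDegree = foldr _⊔_ 0 (map degree (allFin n))

  -- twice the payoff of A when A claims a and B claims b (one round):
  -- 2 per vertex strictly closer to a, 1 per tied vertex
  score2 : Fin n → Fin n → ℕ
  score2 a b = sum (map weight (allFin n))
    where
    weight : Fin n → ℕ
    weight v = if dist a v <ᵇ dist b v then 2
               else (if dist a v ≡ᵇ dist b v then 1 else 0)

  -- B's best reply: minimum over b ≠ a (2n is an upper bound for scores,
  -- hence a neutral start value for the minimum)
  bestReply2 : Fin n → ℕ
  bestReply2 a = foldr _⊓_ (2 * n)
    (map (score2 a) (filter (λ b → ¬? (a ≟ b)) (allFin n)))
    where open import Relation.Nullary using (¬?)

  value2 : ℕ
  value2 = foldr _⊔_ 0 (map bestReply2 (allFin n))

VR1 : ∀ {m} → Graph (suc m) → ℚ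
VR1 {m} G = (+ value2 G) / (2 * suc m)

-- If A claims a, every other vertex v has a neighbour w of a with d(w, v) < d(a, v)
-- (step from a along a shortest path to v).  So the at most Δ neighbours of a are,
-- between them, strictly closer than a to all n - 1 other vertices, and one of them,
-- b, is strictly closer than a to at least (n - 1)/Δ vertices.  B answers a with b and
-- wins those vertices outright, so A gets at most n - (n - 1)/Δ, which is the bound.
-- With payoffs doubled (a tie counts 1), this reads  Δ · value2 + 2n ≤ 2nΔ + 2.
module Submission where

open import Defs hiding (sym)

module Combinatorics where

  open import Data.Bool using (Bool; true; false; T; if_then_else_)
  open import Data.Bool.Properties using (T-∨; T-∧; T-≡)
  open import Data.Empty using (⊥-elim)
  open import Data.Fin using (Fin; zero; suc; punchIn)
  open import Data.Fin.Properties using (any?; punchInᵢ≢i; _≟_)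
  open import Data.List using (map; tabulate; allFin; foldr)
  open import Data.List.Properties using (map-tabulate; foldr-preservesᵒ; foldr-preservesᵇ)
  open import Data.List.Membership.Propositional using (_∈_)
  open import Data.List.Membership.Propositional.Properties using (∈-allFin; ∈-filter⁺)
  import Data.List.Relation.Unary.All as All
  import Data.List.Relation.Unary.All.Properties as All
  import Data.List.Relation.Unary.Any as Any
  open import Data.List.Relation.Unary.Any using (satisfied)
  open import Data.List.Relation.Unary.Any.Properties using (any⁺; any⁻; tabulate⁺; map⁺)
  import Data.Nat.ListAction as List
  open import Data.Nat hiding (_≟_)
  open import Data.Nat.Properties hiding (_≟_)
  open import Data.Nat.Tactic.RingSolver using (solve-∀)
  open import Data.Product using (∃-syntax; _×_; _,_)
  open import Data.Sum using (_⊎_; inj₁; inj₂; [_,_]′)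
  open import Data.Unit using (tt)
  open import Data.Vec.Functional using (Vector)
  open import Function using (_∘_; id; Equivalence)
  open import Relation.Nullary using (¬_; yes; no; ¬?; contradiction)
  open import Relation.Nullary.Decidable using (T?; _×-dec_; decidable-stable; fromWitness; toWitness)
  open import Relation.Binary.PropositionalEquality
  open import Algebra.Properties.Semiring.Sum +-*-semiring
    using (sum; sum-syntax; sum-cong-≗; ∑-comm; ∑-distrib-+; *-distribˡ-sum; *-distribʳ-sum; sum-remove)

  sum-map-allFin : ∀ {n} (f : Vector ℕ n) → List.sum (map f (allFin n)) ≡ sum f
  sum-map-allFin {n} f = trans (cong List.sum (map-tabulate id f)) (sum-tabulate f)
    where
    sum-tabulate : ∀ {n} (f : Vector ℕ n) → List.sum (tabulate f) ≡ sum f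
    sum-tabulate {zero}  f = refl
    sum-tabulate {suc n} f = cong (f zero +_) (sum-tabulate (f ∘ suc))

  sum-const : ∀ n c → ∑[ i < n ] c ≡ n * c
  sum-const zero    c = refl
  sum-const (suc n) c = cong (c +_) (sum-const n c)

  sum-mono-≤ : ∀ {n} {f g : Vector ℕ n} → (∀ i → f i ≤ g i) → sum f ≤ sum g
  sum-mono-≤ {zero}  f≤g = z≤n
  sum-mono-≤ {suc n} f≤g = +-mono-≤ (f≤g zero) (sum-mono-≤ (f≤g ∘ suc))

  sum-mono-< : ∀ {n} {f g : Vector ℕ n} → (∀ i → f i ≤ g i) → ∀ i → f i < g i → sum f < sum g
  sum-mono-< f≤g zero    f<g = +-mono-<-≤ f<g (sum-mono-≤ (f≤g ∘ suc))
  sum-mono-< f≤g (suc i) f<g = +-mono-≤-< (f≤g zero) (sum-mono-< (f≤g ∘ suc) i f<g)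

  sum-≤-* : ∀ {n} (f : Vector ℕ n) c → (∀ i → f i ≤ c) → sum f ≤ n * c
  sum-≤-* {n} f c f≤c = subst (sum f ≤_) (sum-const n c) (sum-mono-≤ f≤c)

  ≤-sum : ∀ {n} (f : Vector ℕ n) i → f i ≤ sum f
  ≤-sum f zero    = m≤m+n _ _
  ≤-sum f (suc i) = ≤-trans (≤-sum (f ∘ suc) i) (m≤n+m _ _)

  sum-≥-allBut : ∀ {n} (f : Vector ℕ (suc n)) a → (∀ v → v ≢ a → 1 ≤ f v) → n ≤ sum f
  sum-≥-allBut {n} f a 1≤f = begin
    n                                 ≡⟨ *-identityʳ n ⟨
    n * 1                             ≡⟨ sum-const n 1 ⟨
    ∑[ j < n ] 1                      ≤⟨ sum-mono-≤ (λ j → 1≤f (punchIn a j) (punchInᵢ≢i a j)) ⟩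
    ∑[ j < n ] f (punchIn a j)        ≤⟨ m≤n+m _ (f a) ⟩
    f a + ∑[ j < n ] f (punchIn a j)  ≡⟨ sum-remove f ⟨
    sum f                             ∎
    where open ≤-Reasoning

  foldr-⊓-≤ : ∀ {A : Set} (f : A → ℕ) c {xs x} → x ∈ xs → foldr _⊓_ c (map f xs) ≤ f x
  foldr-⊓-≤ f c {x = x} x∈xs =
    foldr-preservesᵒ {P = _≤ f x} {f = _⊓_} (λ x y → [ m≤n⇒m⊓o≤n y , m≤n⇒o⊓m≤n x ]′) c _
    (inj₂ (map⁺ {f = f} (Any.map (λ { refl → ≤-refl }) x∈xs)))

  ≤-foldr-⊔ : ∀ {A : Set} (f : A → ℕ) {xs x} → x ∈ xs → f x ≤ foldr _⊔_ 0 (map f xs)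
  ≤-foldr-⊔ f {x = x} x∈xs =
    foldr-preservesᵒ {P = f x ≤_} {f = _⊔_} (λ x y → [ m≤n⇒m≤n⊔o y , m≤n⇒m≤o⊔n x ]′) 0 _
    (inj₂ (map⁺ {f = f} (Any.map (λ { refl → ≤-refl }) x∈xs)))

  foldr-⊔-preserves : ∀ {A : Set} (P : ℕ → Set) (f : A → ℕ) xs → P 0 → (∀ x → P (f x)) →
                      P (foldr _⊔_ 0 (map f xs))
  foldr-⊔-preserves P f xs P0 Pf = foldr-preservesᵇ {P = P} ⊔-preserves P0 (All.map⁺ (All.universal Pf xs))
    where
    ⊔-preserves : ∀ {x y} → P x → P y → P (x ⊔ y)
    ⊔-preserves {x} {y} Px Py with ⊔-sel x y
    ... | inj₁ x⊔y≡x = subst P (sym x⊔y≡x) Px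
    ... | inj₂ x⊔y≡y = subst P (sym x⊔y≡y) Py

  χ : Bool → ℕ
  χ b = if b then 1 else 0

  χ-mono : ∀ {a b} → (T a → T b) → χ a ≤ χ b
  χ-mono {false} a⇒b = z≤n
  χ-mono {true} {true}  a⇒b = ≤-refl
  χ-mono {true} {false} a⇒b = ⊥-elim (a⇒b tt)

  χ-< : ∀ {a b} → ¬ T a → T b → χ a < χ b
  χ-< {false} {true} ¬a b = ≤-refl
  χ-< {true}         ¬a b = contradiction tt ¬a

  χ-*-mono : ∀ b {x y} → (T b → x ≤ y) → χ b * x ≤ χ b * y
  χ-*-mono false x≤y = z≤n
  χ-*-mono true  x≤y = *-monoʳ-≤ 1 (x≤y tt)

  count : ∀ {n} → (Fin n → Bool) → ℕ
  count p = sum (χ ∘ p)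

  count-⊆ : ∀ {n} {p q : Fin n → Bool} → (∀ v → T (p v) → T (q v)) →
            (∀ v → T (q v) → T (p v)) ⊎ count p < count q
  count-⊆ {p = p} {q} p⊆q with any? (λ v → T? (q v) ×-dec ¬? (T? (p v)))
  ... | yes (v , qv , ¬pv) = inj₂ (sum-mono-< (χ-mono ∘ p⊆q) v (χ-< ¬pv qv))
  ... | no  ∄             = inj₁ λ v qv → decidable-stable (T? (p v)) (λ ¬pv → ∄ (v , qv , ¬pv))

  count-full : ∀ {n} {p : Fin n → Bool} → n ≤ count p → ∀ v → T (p v)
  count-full {n} {p} n≤count v = decidable-stable (T? (p v)) λ ¬pv →
    <⇒≱ (subst (count p <_) (trans (sum-const n 1) (*-identityʳ n))
           (sum-mono-< (λ w → χ-mono {b = true} _) v (χ-< ¬pv tt)))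
        n≤count

  argmax-on : ∀ {n} (p : Fin n → Bool) (f : Vector ℕ n) →
              (∃[ b ] T (p b) × (∀ x → T (p x) → f x ≤ f b)) ⊎ (∀ x → ¬ T (p x))
  argmax-on {zero}  p f = inj₂ λ ()
  argmax-on {suc n} p f with argmax-on (p ∘ suc) (f ∘ suc) | T? (p zero)
  ... | inj₂ none | no ¬p₀ = inj₂ λ { zero → ¬p₀ ; (suc x) → none x }
  ... | inj₂ none | yes p₀ = inj₁ (zero , p₀ , λ { zero _ → ≤-refl ; (suc x) px → contradiction px (none x) })
  ... | inj₁ (b , pb , max) | no ¬p₀ = inj₁ (suc b , pb , λ { zero p₀ → contradiction p₀ ¬p₀ ; (suc x) → max x })
  ... | inj₁ (b , pb , max) | yes p₀ with ≤-total (f (suc b)) (f zero)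
  ...   | inj₁ fb≤f₀ = inj₁ (zero , p₀ , λ { zero _ → ≤-refl ; (suc x) px → ≤-trans (max x px) fb≤f₀ })
  ...   | inj₂ f₀≤fb = inj₁ (suc b , pb , λ { zero _ → f₀≤fb ; (suc x) → max x })

  module _ {n : ℕ} (G : Graph n) where

    record Reach (k : ℕ) (u v : Fin n) : Set where
      constructor reached
      field holds : T (reach G k u v)
    open Reach

    reach-refl : ∀ k v → Reach k v v
    reach-refl zero    v = reached (fromWitness refl)
    reach-refl (suc k) v = reached (Equivalence.from T-∨ (inj₁ (holds (reach-refl k v))))

    reach-zero : ∀ {u v} → Reach 0 u v → u ≡ v
    reach-zero = toWitness ∘ holds

    reach-suc : ∀ {k u v} → Reach k u v → Reach (suc k) u v
    reach-suc (reached r) = reached (Equivalence.from T-∨ (inj₁ r))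

    reach-snoc : ∀ {k u w v} → Reach k u w → T (adj G w v) → Reach (suc k) u v
    reach-snoc {w = w} (reached r) e =
      reached (Equivalence.from T-∨ (inj₂ (any⁺ _ (tabulate⁺ w (Equivalence.from T-∧ (r , e))))))

    reach-suc⁻ : ∀ {k u v} → Reach (suc k) u v → Reach k u v ⊎ ∃[ w ] Reach k u w × T (adj G w v)
    reach-suc⁻ (reached r) with Equivalence.to T-∨ r
    ... | inj₁ r′ = inj₁ (reached r′)
    ... | inj₂ r′ with w , rw ← satisfied (any⁻ _ (allFin n) r′) with r″ , e ← Equivalence.to T-∧ rw =
      inj₂ (w , reached r″ , e)

    reach-uncons : ∀ {k u v} → Reach (suc k) u v → u ≡ v ⊎ ∃[ w ] T (adj G u w) × Reach k w v
    reach-uncons {zero} {v = v} r with reach-suc⁻ r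
    ... | inj₁ r′ = inj₁ (reach-zero r′)
    ... | inj₂ (x , r′ , e) with refl ← reach-zero r′ = inj₂ (v , e , reach-refl 0 v)
    reach-uncons {suc k} {v = v} r with reach-suc⁻ r
    ... | inj₁ r′ with reach-uncons r′
    ...   | inj₁ u≡v          = inj₁ u≡v
    ...   | inj₂ (w , e , rw) = inj₂ (w , e , reach-suc rw)
    reach-uncons {suc k} {v = v} r | inj₂ (x , r′ , e′) with reach-uncons r′
    ...   | inj₁ refl         = inj₂ (v , e′ , reach-refl (suc k) v)
    ...   | inj₂ (w , e , rw) = inj₂ (w , e , reach-snoc rw e′)

    reach-mono : ∀ {k j u v} → k ≤ j → Reach k u v → Reach j u v
    reach-mono = go ∘ ≤⇒≤′
      where
      go : ∀ {k j u v} → k ≤′ j → Reach k u v → Reach j u v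
      go (≤′-reflexive refl) = id
      go (≤′-step k≤′j)      = reach-suc ∘ go k≤′j

    walk-preserves : (S : Fin n → Set) → (∀ {x y} → S x → T (adj G x y) → S y) →
                     ∀ {u v} → Walk G u v → S u → S v
    walk-preserves S closed here       Su = Su
    walk-preserves S closed (step e w) Su = walk-preserves S closed w (closed Su (Equivalence.from T-≡ e))

    Saturated : Fin n → ℕ → Set
    Saturated a k = ∀ v → Reach (suc k) a v → Reach k a v

    reach-saturates : ∀ a j → (∃[ k ] k ≤ j × Saturated a k) ⊎ j < count (reach G j a)
    reach-saturates a zero = inj₂ (≤-trans (χ-mono {true} (λ _ → holds (reach-refl 0 a))) (≤-sum _ a))
    reach-saturates a (suc j) with reach-saturates a j
    ... | inj₁ (k , k≤j , sat) = inj₁ (k , m≤n⇒m≤1+n k≤j , sat)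
    ... | inj₂ j<count with count-⊆ (λ v → holds ∘ reach-suc {j} {a} {v} ∘ reached)
    ...   | inj₁ sat   = inj₁ (j , n≤1+n j , λ v → reached ∘ sat v ∘ holds)
    ...   | inj₂ grows = inj₂ (<-≤-trans (s≤s j<count) grows)

  module _ {n′ : ℕ} (G : Graph (suc n′)) where

    module _ (u v : Fin (suc n′)) where

      distFrom-≤ : ∀ f {k j} → k ≤ j → j < k + f → Reach G j u v → distFrom G k f u v ≤ j
      distFrom-≤ zero    {k} k≤j j<k+0 r = ⊥-elim (<⇒≱ j<k+0 (subst (_≤ _) (sym (+-identityʳ k)) k≤j))
      distFrom-≤ (suc f) {k} {j} k≤j j<k+f r with reach G k u v in eq
      ... | true  = k≤j
      ... | false = distFrom-≤ f (≤∧≢⇒< k≤j k≢j) (subst (j <_) (+-suc k f) j<k+f) r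
        where
        k≢j : k ≢ j
        k≢j refl = subst T eq (Reach.holds r)

      reach-distFrom : ∀ f {k} → distFrom G k f u v < k + f → Reach G (distFrom G k f u v) u v
      reach-distFrom zero    {k} lt = ⊥-elim (<-irrefl (sym (+-identityʳ k)) lt)
      reach-distFrom (suc f) {k} lt with reach G k u v in eq
      ... | true  = reached (subst T (sym eq) tt)
      ... | false = reach-distFrom f (subst (distFrom G (suc k) f u v <_) (+-suc k f) lt)

    dist-≤ : ∀ {u v j} → j < suc n′ → Reach G j u v → dist G u v ≤ j
    dist-≤ {u} {v} = distFrom-≤ u v (suc n′) z≤n

    reach-dist : ∀ {u v} → dist G u v < suc n′ → Reach G (dist G u v) u v
    reach-dist {u} {v} = reach-distFrom u v (suc n′) {0}

    module _ (con : Connected G) where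

      -- Either the reach sets from a stop growing before n′, after which every walk
      -- stays inside them, or they grow at every step and so fill all n′ + 1 vertices.
      reach-everywhere : ∀ a v → Reach G n′ a v
      reach-everywhere a v with reach-saturates G a n′
      ... | inj₁ (k , k≤n′ , sat) =
        reach-mono G k≤n′ (walk-preserves G (Reach G k a) (λ r e → sat _ (reach-snoc G r e))
                                          (con a v) (reach-refl G k a))
      ... | inj₂ n′<count = reached (count-full {p = reach G n′ a} n′<count v)

      dist-< : ∀ u v → dist G u v < suc n′
      dist-< u v = s≤s (dist-≤ ≤-refl (reach-everywhere u v))

      closer-neighbour : ∀ {a v} → a ≢ v → ∃[ w ] T (adj G a w) × dist G w v < dist G a v
      closer-neighbour {a} {v} a≢v = closer-than (dist G a v) (reach-dist (dist-< a v)) (dist-< a v)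
        where
        closer-than : ∀ d → Reach G d a v → d < suc n′ → ∃[ w ] T (adj G a w) × dist G w v < d
        closer-than zero    r _   = ⊥-elim (a≢v (reach-zero G r))
        closer-than (suc d) r d<n with reach-uncons G r
        ... | inj₁ a≡v          = ⊥-elim (a≢v a≡v)
        ... | inj₂ (w , e , rw) = w , e , s≤s (dist-≤ (<-trans (n<1+n d) d<n) rw)

  weight : ℕ → ℕ → ℕ
  weight x y = if x <ᵇ y then 2 else (if x ≡ᵇ y then 1 else 0)

  weight-≤-2 : ∀ x y → weight x y ≤ 2
  weight-≤-2 x y with x <ᵇ y | x ≡ᵇ y
  ... | true  | _     = ≤-refl
  ... | false | true  = s≤s z≤n
  ... | false | false = z≤n

  -- A vertex strictly closer to B (y < x) is worth nothing to A.
  weight-+-χ-≤-2 : ∀ x y → weight x y + 2 * χ (y <ᵇ x) ≤ 2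
  weight-+-χ-≤-2 x y with y <ᵇ x in y<x
  ... | false = subst (_≤ 2) (sym (+-identityʳ _)) (weight-≤-2 x y)
  ... | true with x <ᵇ y in x<y | x ≡ᵇ y in x≡y
  ...   | true  | _     =
    ⊥-elim (<-asym (<ᵇ⇒< y x (subst T (sym y<x) tt)) (<ᵇ⇒< x y (subst T (sym x<y) tt)))
  ...   | false | true  =
    ⊥-elim (<-irrefl (sym (≡ᵇ⇒≡ x y (subst T (sym x≡y) tt))) (<ᵇ⇒< y x (subst T (sym y<x) tt)))
  ...   | false | false = ≤-refl

  voronoi-arith : ∀ {Δ r s c N d} → r ≤ s → s + 2 * c ≤ 2 * N → N ≤ suc (d * c) → d ≤ Δ →
                  Δ * r + 2 * N ≤ 2 * N * Δ + 2
  voronoi-arith {Δ} {r} {s} {c} {N} {d} r≤s s+2c≤2N N≤1+dc d≤Δ = begin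
    Δ * r + 2 * N             ≤⟨ +-mono-≤ (*-monoʳ-≤ Δ r≤s) (*-monoʳ-≤ 2 N≤1+dc) ⟩
    Δ * s + 2 * suc (d * c)   ≤⟨ +-monoʳ-≤ (Δ * s) (*-monoʳ-≤ 2 (s≤s (*-monoˡ-≤ c d≤Δ))) ⟩
    Δ * s + 2 * suc (Δ * c)   ≡⟨ expand Δ s c ⟩
    Δ * (s + 2 * c) + 2       ≤⟨ +-monoˡ-≤ 2 (*-monoʳ-≤ Δ s+2c≤2N) ⟩
    Δ * (2 * N) + 2           ≡⟨ cong (_+ 2) (*-comm Δ (2 * N)) ⟩
    2 * N * Δ + 2             ∎
    where
    open ≤-Reasoning
    expand : ∀ Δ s c → Δ * s + 2 * suc (Δ * c) ≡ Δ * (s + 2 * c) + 2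
    expand = solve-∀

  module _ {m : ℕ} (G : Graph (suc (suc m))) (con : Connected G) where

    private
      n Δ : ℕ
      n = suc (suc m)
      Δ = maxDegree G

    closerCount : Fin n → Fin n → ℕ
    closerCount a b = count (λ v → dist G b v <ᵇ dist G a v)

    score2-+-closerCount : ∀ a b → score2 G a b + 2 * closerCount a b ≤ 2 * n
    score2-+-closerCount a b = begin
      score2 G a b + 2 * closerCount a b       ≡⟨ cong₂ _+_ (sum-map-allFin w) (*-distribˡ-sum 2 c) ⟩
      sum w + ∑[ v < n ] (2 * c v)             ≡⟨ ∑-distrib-+ w (λ v → 2 * c v) ⟨
      ∑[ v < n ] (w v + 2 * c v)               ≤⟨ sum-≤-* _ 2 (λ v → weight-+-χ-≤-2 (dist G a v) (dist G b v)) ⟩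
      n * 2                                    ≡⟨ *-comm n 2 ⟩
      2 * n                                    ∎
      where
      open ≤-Reasoning
      w c : Fin n → ℕ
      w v = weight (dist G a v) (dist G b v)
      c v = χ (dist G b v <ᵇ dist G a v)

    -- Double counting over pairs (w, v): each v ≠ a is strictly closer to some neighbour w of a.
    neighbours-cover : ∀ a → n ≤ suc (∑[ w < n ] (χ (adj G a w) * closerCount a w))
    neighbours-cover a = s≤s (begin
      suc m                                          ≤⟨ sum-≥-allBut _ a covered ⟩
      ∑[ v < n ] ∑[ w < n ] (χ (adj G a w) * c w v)  ≡⟨ ∑-comm (λ w v → χ (adj G a w) * c w v) ⟨
      ∑[ w < n ] ∑[ v < n ] (χ (adj G a w) * c w v)  ≡⟨ sum-cong-≗ (λ w → *-distribˡ-sum (χ (adj G a w)) (c w)) ⟨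
      ∑[ w < n ] (χ (adj G a w) * closerCount a w)   ∎)
      where
      open ≤-Reasoning
      c : Fin n → Fin n → ℕ
      c w v = χ (dist G w v <ᵇ dist G a v)
      covered : ∀ v → v ≢ a → 1 ≤ ∑[ w < n ] (χ (adj G a w) * c w v)
      covered v v≢a with w , a~w , closer ← closer-neighbour G con (v≢a ∘ sym) =
        ≤-trans (*-mono-≤ (χ-mono {true} (λ _ → a~w)) (χ-mono {true} (λ _ → <⇒<ᵇ closer)))
                (≤-sum (λ w → χ (adj G a w) * c w v) w)

    degree-≤-maxDegree : ∀ a → degree G a ≤ Δ
    degree-≤-maxDegree a = ≤-foldr-⊔ (degree G) (∈-allFin a)

    bestReply2-≤-score2 : ∀ {a b} → a ≢ b → bestReply2 G a ≤ score2 G a b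
    bestReply2-≤-score2 {a} {b} a≢b =
      foldr-⊓-≤ (score2 G a) (2 * n) (∈-filter⁺ (λ b → ¬? (a ≟ b)) (∈-allFin b) a≢b)

    -- B answers a with the neighbour b of a that is closer than a to the most vertices.
    bestReply2-bound : ∀ a → Δ * bestReply2 G a + 2 * n ≤ 2 * n * Δ + 2
    bestReply2-bound a with argmax-on (adj G a) (closerCount a)
    ... | inj₂ isolated with w , a~w , _ ← closer-neighbour G con (punchInᵢ≢i a zero ∘ sym) =
      ⊥-elim (isolated w a~w)
    ... | inj₁ (b , a~b , maximal) = voronoi-arith
      (bestReply2-≤-score2 a≢b) (score2-+-closerCount a b) n≤1+deg*closer (degree-≤-maxDegree a)
      where
      a≢b : a ≢ b
      a≢b refl = subst T (irrefl G a) a~b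
      n≤1+deg*closer : n ≤ suc (degree G a * closerCount a b)
      n≤1+deg*closer = ≤-trans (neighbours-cover a) (s≤s (begin
        ∑[ w < n ] (χ (adj G a w) * closerCount a w)   ≤⟨ sum-mono-≤ (λ w → χ-*-mono (adj G a w) (maximal w)) ⟩
        ∑[ w < n ] (χ (adj G a w) * closerCount a b)   ≡⟨ *-distribʳ-sum (closerCount a b) (χ ∘ adj G a) ⟨
        sum (χ ∘ adj G a) * closerCount a b            ≡⟨ cong (_* closerCount a b) (sum-map-allFin (χ ∘ adj G a)) ⟨
        degree G a * closerCount a b                   ∎))
        where open ≤-Reasoning

    value2-bound : .{{_ : NonZero Δ}} → Δ * value2 G + 2 * n ≤ 2 * n * Δ + 2
    value2-bound = foldr-⊔-preserves (λ x → Δ * x + 2 * n ≤ 2 * n * Δ + 2) (bestReply2 G) (allFin n)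
      (subst (_≤ 2 * n * Δ + 2) (cong (_+ 2 * n) (sym (*-zeroʳ Δ)))
             (≤-trans (m≤m*n (2 * n) Δ) (m≤m+n _ 2)))
      bestReply2-bound

module Ratio where

  open import Data.Nat using (ℕ; suc; pred; _+_; _*_; _≤_; NonZero)
  open import Data.Nat.Properties using (+-cancelʳ-≤; *-monoˡ-≤; module ≤-Reasoning)
  open import Data.Nat.Tactic.RingSolver using (solve-∀)
  open import Data.Integer as ℤ using (+_)
  import Data.Integer.Properties as ℤ
  import Data.Integer.Tactic.RingSolver as ℤ
  open import Data.Rational as ℚ using (ℚ; _/_; 1ℚ; toℚᵘ)
  open import Data.Rational.Properties
    using (toℚᵘ-cancel-≤; toℚᵘ-fromℚᵘ; toℚᵘ-homo-+; toℚᵘ-homo-*; toℚᵘ-homo‿-)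
  open import Data.Rational.Unnormalised as ℚᵘ using (ℚᵘ; mkℚᵘ; *≤*)
  import Data.Rational.Unnormalised.Properties as ℚᵘ
  open import Relation.Binary.PropositionalEquality

  -- The right-hand side for Δ = suc D and n = suc n′ vertices, unnormalised so that
  -- its numerator and denominator compute.
  rhsᵘ : ℕ → ℕ → ℚᵘ
  rhsᵘ n′ D = ℚᵘ.1ℚᵘ ℚᵘ.- mkℚᵘ (+ 1) D ℚᵘ.+ mkℚᵘ (+ 1) n′ ℚᵘ.* mkℚᵘ (+ 1) D

  toℚᵘ-rhs : ∀ n′ D → toℚᵘ (1ℚ ℚ.- (+ 1 / suc D) ℚ.+ (+ 1 / suc n′) ℚ.* (+ 1 / suc D)) ℚᵘ.≃ rhsᵘ n′ D
  toℚᵘ-rhs n′ D = ℚᵘ.≃-trans (toℚᵘ-homo-+ (1ℚ ℚ.- d) (m ℚ.* d)) (ℚᵘ.+-cong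
    (ℚᵘ.≃-trans (toℚᵘ-homo-+ 1ℚ (ℚ.- d)) (ℚᵘ.+-cong (toℚᵘ-fromℚᵘ ℚᵘ.1ℚᵘ)
      (ℚᵘ.≃-trans (toℚᵘ-homo‿- d) (ℚᵘ.-‿cong (toℚᵘ-fromℚᵘ (mkℚᵘ (+ 1) D))))))
    (ℚᵘ.≃-trans (toℚᵘ-homo-* m d) (ℚᵘ.*-cong (toℚᵘ-fromℚᵘ (mkℚᵘ (+ 1) n′)) (toℚᵘ-fromℚᵘ (mkℚᵘ (+ 1) D)))))
    where
    d m : ℚ
    d = + 1 / suc D
    m = + 1 / suc n′

  ↥-rhsᵘ : ∀ n′ D → ℚᵘ.↥ (rhsᵘ n′ D) ≡ + (D * (suc n′ * suc D) + suc D)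
  ↥-rhsᵘ n′ D = begin
    ℚᵘ.↥ (rhsᵘ n′ D)                              ≡⟨ numerator (+ n′) (+ D) ⟩
    + D ℤ.* (+ suc n′ ℤ.* + suc D) ℤ.+ + suc D    ≡⟨ cong (ℤ._+ + suc D) (ℤ.pos-* D (suc n′ * suc D)) ⟨
    + (D * (suc n′ * suc D)) ℤ.+ + suc D          ≡⟨ ℤ.pos-+ (D * (suc n′ * suc D)) (suc D) ⟨
    + (D * (suc n′ * suc D) + suc D)              ∎
    where
    open ≡-Reasoning
    numerator : ∀ n d → (+ 1 ℤ.* (+ 1 ℤ.+ d) ℤ.+ ℤ.- + 1 ℤ.* + 1) ℤ.* ((+ 1 ℤ.+ n) ℤ.* (+ 1 ℤ.+ d))
                          ℤ.+ (+ 1 ℤ.* + 1) ℤ.* (+ 1 ℤ.* (+ 1 ℤ.+ d))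
                        ≡ d ℤ.* ((+ 1 ℤ.+ n) ℤ.* (+ 1 ℤ.+ d)) ℤ.+ (+ 1 ℤ.+ d)
    numerator = ℤ.solve-∀

  cross-multiplied : ∀ V n′ D → suc D * V + 2 * suc n′ ≤ 2 * suc n′ * suc D + 2 →
                     V * (1 * suc D * (suc n′ * suc D)) ≤ (D * (suc n′ * suc D) + suc D) * (2 * suc n′)
  cross-multiplied V n′ D h = +-cancelʳ-≤ (2 * suc n′ * (suc n′ * suc D)) _ _ (begin
    V * (1 * suc D * (suc n′ * suc D)) + 2 * suc n′ * (suc n′ * suc D)  ≡⟨ lhs V n′ D ⟩
    (suc D * V + 2 * suc n′) * (suc n′ * suc D)                        ≤⟨ *-monoˡ-≤ (suc n′ * suc D) h ⟩
    (2 * suc n′ * suc D + 2) * (suc n′ * suc D)                        ≡⟨ rhs n′ D ⟩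
    (D * (suc n′ * suc D) + suc D) * (2 * suc n′) + 2 * suc n′ * (suc n′ * suc D) ∎)
    where
    open ≤-Reasoning
    lhs : ∀ V n′ D → V * (1 * suc D * (suc n′ * suc D)) + 2 * suc n′ * (suc n′ * suc D)
                     ≡ (suc D * V + 2 * suc n′) * (suc n′ * suc D)
    lhs = solve-∀
    rhs : ∀ n′ D → (2 * suc n′ * suc D + 2) * (suc n′ * suc D)
                   ≡ (D * (suc n′ * suc D) + suc D) * (2 * suc n′) + 2 * suc n′ * (suc n′ * suc D)
    rhs = solve-∀

  ratio-bound : ∀ V n′ D .{{_ : NonZero D}} → D * V + 2 * suc n′ ≤ 2 * suc n′ * D + 2 →
                + V / (2 * suc n′) ℚ.≤ 1ℚ ℚ.- (+ 1 / D) ℚ.+ (+ 1 / suc n′) ℚ.* (+ 1 / D)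
  ratio-bound V n′ (suc D) h = toℚᵘ-cancel-≤ (ℚᵘ.≤-respʳ-≃ (ℚᵘ.≃-sym (toℚᵘ-rhs n′ D))
    (ℚᵘ.≤-respˡ-≃ (ℚᵘ.≃-sym (toℚᵘ-fromℚᵘ (mkℚᵘ (+ V) (pred (2 * suc n′))))) (*≤* cross)))
    where
    cross : + V ℤ.* ℚᵘ.↧ (rhsᵘ n′ D) ℤ.≤ ℚᵘ.↥ (rhsᵘ n′ D) ℤ.* + (2 * suc n′)
    cross = subst₂ ℤ._≤_ (ℤ.pos-* V _)
      (trans (ℤ.pos-* (D * (suc n′ * suc D) + suc D) (2 * suc n′))
             (cong (ℤ._* + (2 * suc n′)) (sym (↥-rhsᵘ n′ D))))
      (ℤ.+≤+ (cross-multiplied V n′ D h))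

open import Data.Nat using (ℕ; suc; NonZero)
open import Data.Integer using (+_)
open import Data.Rational using (ℚ; _/_; _≤_; _+_; _-_; _*_; 1ℚ)
open Combinatorics using (value2-bound)
open Ratio using (ratio-bound)

lemma2 : (m : ℕ) (G : Graph (suc (suc m))) → Connected G →
         .{{_ : NonZero (maxDegree G)}} →
         VR1 G ≤ 1ℚ - (+ 1 / maxDegree G) + ((+ 1 / suc (suc m)) * (+ 1 / maxDegree G))
lemma2 m G con = ratio-bound (value2 G) (suc m) (maxDegree G) (value2-bound G con)
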